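{- Let $n\ge 3$ and let $h:[n]\to[n]$ be a connected Hessenberg function such that $|\{i: i<n-1,\ h(i)\ge n-1\}|=|\{i: i<n,\ h(i)=n\}|$. Then: (1) the set $\{i: i<n-1,\ h(i)\ge n-1\}$ is nonempty; (2) setting $j=\min\{i: i<n-1,\ h(i)\ge n-1\}$, $j$ is the unique element of $[n]$ with $h(j)=n-1$; (3) $\deg f_0=\deg g_0=n-j-1$; (4) if $|\{i: i<n-1,\ h(i)\ge n-1\}|=|\{i:i<n,\ h(i)=n\}|\ge 2$, then $j<n-2$.
   Context: $[n]=\{1,\dots,n\}$. A Hessenberg function is a nondecreasing $h:[n]\to[n]$ with $h(i)\ge i$; it is connected if $h(i)>i$ for all $i\in[n-1]$. Let $\lambda=(1,n-1)$ and for $0\le k\le n-1$ let $u_k\in S_n$ have one-line notation $[2,3,\dots,k+1,1,k+2,\dots,n]$. Let $\mathcal S_k=\{t_a-t_b:a<b,\ u_k^{ -1}(a)>u_k^{ -1}(b),\ u_k^{ -1}(a)\le h(u_k^{ -1}(b))\}$. Let $f_0=f^{(n-2)}_\lambda$ and $g_0=f^{(n-1)}_\lambda$, where $f^{(k)}_\lambda(yu_m)=\prod_{t_a-t_b\in\mathcal S_k}(t_{y(a)}-t_{y(b)})$ if $u_m\ge u_k$ in Bruhat order and $0$ otherwise ($y$ in the stabilizer of $1$ in $S_n$, $0\le m\le n-1$); $\deg f^{(k)}_\lambda$ denotes the polynomial degree $|\mathcal S_k|$ of its nonzero values. -}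

module Defs where

open import Data.Nat using (ℕ; zero; suc; _+_; _∸_; _≤_; _<_; _≤?_; _<?_; _≟_)
open import Data.List using (List; []; _∷_; map; filter; length; upTo; concatMap)
open import Data.Product using (_×_; _,_)
open import Relation.Nullary using (Dec; yes; no)
open import Relation.Nullary.Decidable using (_×-dec_)
open import Relation.Binary.PropositionalEquality using (_≡_)

range : ℕ → List ℕ
range n = map suc (upTo n)

-- h : [n] → [n] represented as h : ℕ → ℕ; only values on [n] matter.
record Hessenberg (n : ℕ) (h : ℕ → ℕ) : Set where
  field
    inRange    : ∀ i → 1 ≤ i → i ≤ n → h i ≤ n
    extensive  : ∀ i → 1 ≤ i → i ≤ n → i ≤ h i
    monotone   : ∀ i j → 1 ≤ i → i ≤ j → j ≤ n → h i ≤ h j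

Connected : ℕ → (ℕ → ℕ) → Set
Connected n h = ∀ i → 1 ≤ i → i ≤ n ∸ 1 → i < h i

InA : ℕ → (ℕ → ℕ) → ℕ → Set
InA n h i = (1 ≤ i × i ≤ n) × (i < n ∸ 1 × n ∸ 1 ≤ h i)

inA? : ∀ n h i → Dec (InA n h i)
inA? n h i = ((1 ≤? i) ×-dec (i ≤? n)) ×-dec ((i <? n ∸ 1) ×-dec (n ∸ 1 ≤? h i))

cardA : ℕ → (ℕ → ℕ) → ℕ
cardA n h = length (filter (inA? n h) (range n))

InB : ℕ → (ℕ → ℕ) → ℕ → Set
InB n h i = i < n × h i ≡ n

inB? : ∀ n h i → Dec (InB n h i)
inB? n h i = (i <? n) ×-dec (h i ≟ n)

cardB : ℕ → (ℕ → ℕ) → ℕ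
cardB n h = length (filter (inB? n h) (range n))

-- u_k in one-line notation [2,3,…,k+1,1,k+2,…,n]
u : ℕ → ℕ → ℕ
u k i with i ≤? k
... | yes _ = suc i
... | no _ with i ≟ suc k
...   | yes _ = 1
...   | no _ = i

-- u_k^{-1}(a): the (first) i ∈ [n] with u_k(i) = a (0 if none)
uinvFrom : ℕ → ℕ → List ℕ → ℕ
uinvFrom k a [] = 0
uinvFrom k a (i ∷ is) with u k i ≟ a
... | yes _ = i
... | no _ = uinvFrom k a is

uinv : ℕ → ℕ → ℕ → ℕ
uinv n k a = uinvFrom k a (range n)

InS : ℕ → (ℕ → ℕ) → ℕ → ℕ × ℕ → Set
InS n h k (a , b) =
  a < b × (uinv n k b < uinv n k a × uinv n k a ≤ h (uinv n k b))

inS? : ∀ n h k p → Dec (InS n h k p)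
inS? n h k (a , b) =
  (a <? b) ×-dec ((uinv n k b <? uinv n k a) ×-dec (uinv n k a ≤? h (uinv n k b)))

pairs : ℕ → List (ℕ × ℕ)
pairs n = concatMap (λ a → map (λ b → (a , b)) (range n)) (range n)

-- S_k as a list of pairs (a,b) ∈ [n]², representing t_a - t_b (distinct pairs give
-- distinct roots t_a - t_b)
S : ℕ → (ℕ → ℕ) → ℕ → List (ℕ × ℕ)
S n h k = filter (inS? n h k) (pairs n)

-- deg f^{(k)}_λ = |S_k|
degf : ℕ → (ℕ → ℕ) → ℕ → ℕ
degf n h k = length (S n h k)

deg-f0 : ℕ → (ℕ → ℕ) → ℕ
deg-f0 n h = degf n h (n ∸ 2)

deg-g0 : ℕ → (ℕ → ℕ) → ℕ
deg-g0 n h = degf n h (n ∸ 1)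

-- For a threshold t, monotonicity makes {y ∈ [n] : t ≤ h y} a final segment [J_t, n].
-- Thus A = [j, n-2] and B = [j′, n-1] with j = J_(n-1), j′ = J_n, so |A| = |B| forces
-- j′ = j + 1: j is the one point where h takes the value n-1.
-- As u_k⁻¹ sends 1 ↦ k+1, a ↦ a-1 on [2, k+1] and fixes the rest, the only pairs in S_k
-- are (1, b) with 2 ≤ b ≤ k+1 and k+1 ≤ h(b-1), i.e. J_(k+1) < b ≤ k+1; so
-- |S_k| = k+1 - J_(k+1), which is n-1-j for both k = n-2 and k = n-1.
module Submission where

open import Defs
open import Data.Nat using (ℕ; zero; suc; _+_; _≤_; _<_; _∸_; z≤n; s≤s; s≤s⁻¹; s<s⁻¹; z<s; pred; _≤?_; _≟_)
open import Data.Nat.Properties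
open import Data.List using (List; []; _∷_; map; filter; length; applyUpTo; _++_; concatMap)
open import Data.List.Properties using (filter-accept; filter-reject; filter-++; filter-none; length-++; map-upTo)
open import Data.List.Relation.Unary.All using (All)
open import Data.List.Relation.Unary.All.Properties using (applyUpTo⁺₁; concat⁺; map⁺)
open import Data.Product using (Σ; _×_; _,_; proj₁; proj₂)
open import Function using (_∘_; _⇔_; mk⇔; Equivalence)
open import Relation.Nullary using (¬_; yes; no; contradiction)
open import Relation.Unary using (Decidable)
open import Relation.Binary using (tri<; tri≈; tri>)
open import Relation.Binary.PropositionalEquality

open Equivalence using (to; from)

interval-suc⁻¹ : ∀ {B : Set} {a b i} → B ⇔ (suc a ≤ suc i × suc i < suc b) → B ⇔ (a ≤ i × i < b)
interval-suc⁻¹ B⇔ = mk⇔ (λ p → let (a≤ , <b) = to B⇔ p in s≤s⁻¹ a≤ , s<s⁻¹ <b)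
                       (λ (a≤ , <b) → from B⇔ (s≤s a≤ , s≤s <b))

count : {A : Set} {P : A → Set} → Decidable P → List A → ℕ
count P? xs = length (filter P? xs)

module _ {A : Set} {P : A → Set} (P? : Decidable P) where

  count-++ : ∀ xs ys → count P? (xs ++ ys) ≡ count P? xs + count P? ys
  count-++ xs ys = trans (cong length (filter-++ P? xs ys)) (length-++ (filter P? xs))

  count-map : ∀ {B : Set} (g : B → A) xs → count P? (map g xs) ≡ count (P? ∘ g) xs
  count-map g [] = refl
  count-map g (x ∷ xs) with P? (g x)
  ... | yes _ = cong suc (count-map g xs)
  ... | no _  = count-map g xs

  count-applyUpTo-prefix : ∀ (f : ℕ → A) K b → b ≤ K →
    (∀ i → i < K → P (f i) ⇔ i < b) → count P? (applyUpTo f K) ≡ b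
  count-applyUpTo-prefix f K zero _ P⇔ =
    cong length (filter-none P? (applyUpTo⁺₁ f K λ {i} i<K → n≮0 ∘ to (P⇔ i i<K)))
  count-applyUpTo-prefix f (suc K) (suc b) b≤K P⇔ = begin
    count P? (applyUpTo f (suc K))        ≡⟨ cong length (filter-accept P? (from (P⇔ 0 z<s) z<s)) ⟩
    suc (count P? (applyUpTo (f ∘ suc) K)) ≡⟨ cong suc (count-applyUpTo-prefix (f ∘ suc) K b (s≤s⁻¹ b≤K) P⇔′) ⟩
    suc b                                  ∎
    where
    open ≡-Reasoning
    P⇔′ : ∀ i → i < K → P (f (suc i)) ⇔ i < b
    P⇔′ i i<K = mk⇔ (s<s⁻¹ ∘ to (P⇔ (suc i) (s≤s i<K))) (from (P⇔ (suc i) (s≤s i<K)) ∘ s≤s)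

  count-applyUpTo-interval : ∀ (f : ℕ → A) K a b → a ≤ b → b ≤ K →
    (∀ i → i < K → P (f i) ⇔ (a ≤ i × i < b)) → count P? (applyUpTo f K) ≡ b ∸ a
  count-applyUpTo-interval f K zero b _ b≤K P⇔ =
    count-applyUpTo-prefix f K b b≤K λ i i<K → mk⇔ (proj₂ ∘ to (P⇔ i i<K)) (λ i<b → from (P⇔ i i<K) (z≤n , i<b))
  count-applyUpTo-interval f (suc K) (suc a) (suc b) a≤b b≤K P⇔ =
    trans (cong length (filter-reject P? (n≮0 ∘ proj₁ ∘ to (P⇔ 0 z<s))))
          (count-applyUpTo-interval (f ∘ suc) K a b (s≤s⁻¹ a≤b) (s≤s⁻¹ b≤K)
            λ i i<K → interval-suc⁻¹ (P⇔ (suc i) (s≤s i<K)))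

module _ {P : ℕ → Set} (P? : Decidable P) where

  count-range-interval : ∀ n lo hi → 1 ≤ lo → lo ≤ hi → hi ≤ suc n →
    (∀ x → 1 ≤ x → x ≤ n → P x ⇔ (lo ≤ x × x < hi)) → count P? (range n) ≡ hi ∸ lo
  count-range-interval n (suc a) (suc b) _ a≤b b≤n P⇔ =
    trans (cong (count P?) (map-upTo suc n))
          (count-applyUpTo-interval P? suc n a b (s≤s⁻¹ a≤b) (s≤s⁻¹ b≤n)
            λ i i<n → interval-suc⁻¹ (P⇔ (suc i) z<s i<n))

module _ {P : ℕ × ℕ → Set} (P? : Decidable P) where

  count-pairs-firstRow : ∀ n → (∀ a b → 2 ≤ a → a ≤ n → 1 ≤ b → b ≤ n → ¬ P (a , b)) →
    count P? (pairs n) ≡ count (P? ∘ (1 ,_)) (range n)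
  count-pairs-firstRow zero _ = refl
  count-pairs-firstRow (suc n) ¬P = begin
    count P? (row 1 ++ rest)                  ≡⟨ count-++ P? (row 1) rest ⟩
    count P? (row 1) + count P? rest          ≡⟨ cong₂ _+_ (count-map P? (1 ,_) (range (suc n)))
                                                             (cong length (filter-none P? rest-rejected)) ⟩
    count (P? ∘ (1 ,_)) (range (suc n)) + 0   ≡⟨ +-identityʳ _ ⟩
    count (P? ∘ (1 ,_)) (range (suc n))       ∎
    where
    open ≡-Reasoning
    row : ℕ → List (ℕ × ℕ)
    row a = map (a ,_) (range (suc n))
    -- pairs (suc n) unfolds definitionally to row 1 ++ rest.
    rest : List (ℕ × ℕ)
    rest = concatMap row (map suc (applyUpTo suc n))
    row-rejected : ∀ a → 2 ≤ a → a ≤ suc n → All (¬_ ∘ P) (row a)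
    row-rejected a 2≤a a≤n = map⁺ (map⁺ (applyUpTo⁺₁ _ (suc n) λ i<n → ¬P a _ 2≤a a≤n z<s i<n))
    rest-rejected : All (¬_ ∘ P) rest
    rest-rejected = concat⁺ (map⁺ (map⁺ (applyUpTo⁺₁ _ n λ i<n → row-rejected _ (s≤s (s≤s z≤n)) (s≤s i<n))))

IsThreshold : ℕ → (ℕ → ℕ) → ℕ → ℕ → Set
IsThreshold n h t j = ∀ y → 1 ≤ y → y ≤ n → t ≤ h y ⇔ j ≤ y

threshold-exists : ∀ {n h} → Hessenberg n h → ∀ t m → suc m ≤ n → t ≤ h (suc m) →
  Σ ℕ λ j → 1 ≤ j × j ≤ suc m × IsThreshold n h t j
threshold-exists {n} {h} H t zero _ t≤h1 =
  1 , ≤-refl , ≤-refl , λ y 1≤y y≤n → mk⇔ (λ _ → 1≤y) (λ _ → ≤-trans t≤h1 (monotone 1 y ≤-refl 1≤y y≤n))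
  where open Hessenberg H
threshold-exists {n} {h} H t (suc m) m<n t≤h with t ≤? h (suc m)
... | yes t≤h′ with threshold-exists H t m (<⇒≤ m<n) t≤h′
...   | j , 1≤j , j≤m , thr = j , 1≤j , m≤n⇒m≤1+n j≤m , thr
threshold-exists {n} {h} H t (suc m) m<n t≤h | no t≰h′ = suc (suc m) , s≤s z≤n , ≤-refl , λ y 1≤y y≤n →
  mk⇔ (λ t≤hy → ≮⇒≥ λ y≤m → t≰h′ (≤-trans t≤hy (monotone y (suc m) 1≤y (s≤s⁻¹ y≤m) (<⇒≤ m<n))))
      (λ m≤y → ≤-trans t≤h (monotone (suc (suc m)) y (s≤s z≤n) m≤y y≤n))
  where open Hessenberg H

level-set-of-consecutive-thresholds : ∀ {n h t j} → IsThreshold n h t j → IsThreshold n h (suc t) (suc j) →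
  1 ≤ j → j ≤ n → h j ≡ t × (∀ i → 1 ≤ i → i ≤ n → h i ≡ t → i ≡ j)
level-set-of-consecutive-thresholds {j = j} thr thr′ 1≤j j≤n =
  ≤-antisym (≮⇒≥ λ t<hj → <-irrefl refl (to (thr′ j 1≤j j≤n) t<hj)) (from (thr j 1≤j j≤n) ≤-refl) ,
  λ i 1≤i i≤n hi≡t → ≤-antisym
    (≮⇒≥ λ j<i → <-irrefl (sym hi≡t) (from (thr′ i 1≤i i≤n) j<i))
    (to (thr i 1≤i i≤n) (≤-reflexive (sym hi≡t)))

cardA-threshold : ∀ {n h j} → 1 ≤ j → j ≤ n ∸ 1 → IsThreshold n h (n ∸ 1) j → cardA n h ≡ n ∸ 1 ∸ j
cardA-threshold {n} {h} {j} 1≤j j≤n-1 thr =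
  count-range-interval (inA? n h) n j (n ∸ 1) 1≤j j≤n-1 (≤-trans (m∸n≤m n 1) (n≤1+n n)) λ x 1≤x x≤n →
    mk⇔ (λ (_ , x<n , t≤hx) → to (thr x 1≤x x≤n) t≤hx , x<n)
        (λ (j≤x , x<n) → (1≤x , x≤n) , x<n , from (thr x 1≤x x≤n) j≤x)

cardB-threshold : ∀ {n h j} → Hessenberg n h → 1 ≤ j → j ≤ n → IsThreshold n h n j → cardB n h ≡ n ∸ j
cardB-threshold {n} {h} {j} H 1≤j j≤n thr =
  count-range-interval (inB? n h) n j n 1≤j j≤n (n≤1+n n) λ x 1≤x x≤n →
    mk⇔ (λ (x<n , hx≡n) → to (thr x 1≤x x≤n) (≤-reflexive (sym hx≡n)) , x<n)
        (λ (j≤x , x<n) → x<n , ≤-antisym (Hessenberg.inRange H x 1≤x x≤n) (from (thr x 1≤x x≤n) j≤x))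

equal-cards⇒consecutive-thresholds : ∀ {n h j j′} → Hessenberg (suc n) h →
  1 ≤ j → j ≤ n → IsThreshold (suc n) h n j → 1 ≤ j′ → j′ ≤ suc n → IsThreshold (suc n) h (suc n) j′ →
  cardA (suc n) h ≡ cardB (suc n) h → j′ ≡ suc j
equal-cards⇒consecutive-thresholds H 1≤j j≤n thr 1≤j′ j′≤n thr′ cardA≡cardB =
  sym (∸-cancelˡ-≡ (s≤s j≤n) j′≤n
    (trans (sym (cardA-threshold 1≤j j≤n thr)) (trans cardA≡cardB (cardB-threshold H 1≤j′ j′≤n thr′))))

u-≤ : ∀ {k i} → i ≤ k → u k i ≡ suc i
u-≤ {k} {i} i≤k with i ≤? k
... | yes _  = refl
... | no i≰k = contradiction i≤k i≰k

u-suc : ∀ k → u k (suc k) ≡ 1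
u-suc k with suc k ≤? k
... | yes k<k = contradiction k<k (<-irrefl refl)
... | no _ with suc k ≟ suc k
...   | yes _ = refl
...   | no ≢  = contradiction refl ≢

u-> : ∀ {k i} → suc k < i → u k i ≡ i
u-> {k} {i} k<i with i ≤? k
... | yes i≤k = contradiction (≤-trans i≤k (n≤1+n k)) (<⇒≱ k<i)
... | no _ with i ≟ suc k
...   | yes i≡k = contradiction (sym i≡k) (<⇒≢ k<i)
...   | no _    = refl

uinvFrom-applyUpTo : ∀ k a (f : ℕ → ℕ) K i → i < K → u k (f i) ≡ a →
  (∀ i′ → i′ < i → u k (f i′) ≢ a) → uinvFrom k a (applyUpTo f K) ≡ f i
uinvFrom-applyUpTo k a f (suc K) zero _ uf0≡a _ with u k (f 0) ≟ a
... | yes _ = refl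
... | no ≢  = contradiction uf0≡a ≢
uinvFrom-applyUpTo k a f (suc K) (suc i) i<K ufi≡a earlier with u k (f 0) ≟ a
... | yes uf0≡a = contradiction uf0≡a (earlier 0 z<s)
... | no _      = uinvFrom-applyUpTo k a (f ∘ suc) K i (s<s⁻¹ i<K) ufi≡a (λ i′ → earlier (suc i′) ∘ s≤s)

uinv-first : ∀ n k a i → i < n → u k (suc i) ≡ a →
  (∀ i′ → i′ < i → u k (suc i′) ≢ a) → uinv n k a ≡ suc i
uinv-first n k a i i<n usi≡a earlier =
  trans (cong (uinvFrom k a) (map-upTo suc n)) (uinvFrom-applyUpTo k a suc n i i<n usi≡a earlier)

uinv-1 : ∀ {n k} → k < n → uinv n k 1 ≡ suc k
uinv-1 {n} {k} k<n = uinv-first n k 1 k k<n (u-suc k) λ i′ i′<k e → contradiction (trans (sym (u-≤ i′<k)) e) λ ()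

uinv-≤ : ∀ {n k i} → i < k → k < n → uinv n k (suc (suc i)) ≡ suc i
uinv-≤ {n} {k} {i} i<k k<n = uinv-first n k _ i (<-trans i<k k<n) (u-≤ i<k)
  λ i′ i′<i e → <⇒≢ i′<i (suc-injective (suc-injective (trans (sym (u-≤ (<-trans i′<i i<k))) e)))

uinv-> : ∀ {n k a} → suc k < a → a ≤ n → uinv n k a ≡ a
uinv-> {n} {k} {suc i} k<a a≤n = uinv-first n k _ i a≤n (u-> k<a) earlier
  where
  earlier : ∀ i′ → i′ < i → u k (suc i′) ≢ suc i
  earlier i′ i′<i e with <-cmp (suc i′) (suc k)
  ... | tri< i′<k _ _ = <⇒≱ k<a (≤-trans (≤-reflexive (trans (sym e) (u-≤ (s≤s⁻¹ i′<k)))) i′<k)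
  ... | tri≈ _ i′≡k _ = <⇒≱ k<a (≤-trans (≤-reflexive (trans (sym e) (trans (cong (u k) i′≡k) (u-suc k)))) (s≤s z≤n))
  ... | tri> _ _ k<i′ = <⇒≢ (s≤s i′<i) (trans (sym (u-> k<i′)) e)

uinv-bounds : ∀ {n k a} → k < n → 2 ≤ a → a ≤ n → pred a ≤ uinv n k a × uinv n k a ≤ a
uinv-bounds {n} {k} {a@(suc (suc i))} k<n (s≤s (s≤s z≤n)) a≤n with a ≤? suc k
... | yes a≤k = ≤-reflexive (sym (uinv-≤ (s≤s⁻¹ a≤k) k<n)) , ≤-trans (≤-reflexive (uinv-≤ (s≤s⁻¹ a≤k) k<n)) (n≤1+n _)
... | no a≰k  = ≤-trans (n≤1+n _) (≤-reflexive (sym (uinv-> (≰⇒> a≰k) a≤n))) , ≤-reflexive (uinv-> (≰⇒> a≰k) a≤n)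

¬InS-row≥2 : ∀ {n h k a b} → k < n → 2 ≤ a → a ≤ n → b ≤ n → ¬ InS n h k (a , b)
¬InS-row≥2 {n} {h} {k} {a} {b} k<n 2≤a a≤n b≤n (a<b , ub<ua , _) = <⇒≱ ub<ua (begin
  uinv n k a ≤⟨ proj₂ (uinv-bounds k<n 2≤a a≤n) ⟩
  a          ≤⟨ <⇒≤pred a<b ⟩
  pred b     ≤⟨ proj₁ (uinv-bounds k<n (≤-trans 2≤a (<⇒≤ a<b)) b≤n) ⟩
  uinv n k b ∎)
  where open ≤-Reasoning

InS-firstRow : ∀ {n h k J} → k < n → 1 ≤ J → IsThreshold n h (suc k) J →
  ∀ b → 1 ≤ b → b ≤ n → InS n h k (1 , b) ⇔ (suc J ≤ b × b < suc (suc k))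
InS-firstRow k<n 1≤J _ (suc zero) _ _ =
  mk⇔ (λ (1<1 , _) → contradiction 1<1 (<-irrefl refl)) (λ (J<1 , _) → contradiction (≤-trans (s≤s 1≤J) J<1) λ { (s≤s ()) })
InS-firstRow {n} {h} {k} {J} k<n _ thr b@(suc (suc i)) _ b≤n = mk⇔ to′ from′
  where
  thr-i : suc k ≤ h (suc i) ⇔ J ≤ suc i
  thr-i = thr (suc i) z<s (≤-trans (n≤1+n _) b≤n)
  to′ : InS n h k (1 , b) → suc J ≤ b × b < suc (suc k)
  to′ (_ , ub<u1 , u1≤h) rewrite uinv-1 {n} k<n with b ≤? suc k
  ... | yes b≤k rewrite uinv-≤ {n} (s≤s⁻¹ b≤k) k<n = s≤s (to thr-i u1≤h) , s≤s b≤k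
  ... | no b≰k  rewrite uinv-> {n} (≰⇒> b≰k) b≤n = contradiction ub<u1 (<-asym (≰⇒> b≰k))
  from′ : suc J ≤ b × b < suc (suc k) → InS n h k (1 , b)
  from′ (J<b , b≤k) rewrite uinv-1 {n} k<n | uinv-≤ {n} (s≤s⁻¹ (s≤s⁻¹ b≤k)) k<n =
    s≤s (s≤s z≤n) , s≤s⁻¹ b≤k , from thr-i (s≤s⁻¹ J<b)

degf-threshold : ∀ {n h k J} → k < n → 1 ≤ J → J ≤ suc k → IsThreshold n h (suc k) J →
  degf n h k ≡ suc k ∸ J
degf-threshold {n} {h} {k} {J} k<n 1≤J J≤k thr = begin
  degf n h k                                 ≡⟨ count-pairs-firstRow (inS? n h k) n
                                                  (λ a b 2≤a a≤n _ b≤n → ¬InS-row≥2 {h = h} k<n 2≤a a≤n b≤n) ⟩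
  count (λ b → inS? n h k (1 , b)) (range n) ≡⟨ count-range-interval (λ b → inS? n h k (1 , b)) n _ _
                                                  (s≤s z≤n) (s≤s J≤k) (s≤s k<n) (InS-firstRow k<n 1≤J thr) ⟩
  suc k ∸ J                                  ∎
  where open ≡-Reasoning

lemma6p1 : (n : ℕ) (h : ℕ → ℕ) → 3 ≤ n → Hessenberg n h → Connected n h →
    cardA n h ≡ cardB n h →
    Σ ℕ (λ j →
      (InA n h j × (∀ i → InA n h i → j ≤ i)) ×
      ((h j ≡ n ∸ 1 × (∀ i → 1 ≤ i → i ≤ n → h i ≡ n ∸ 1 → i ≡ j)) ×
       ((deg-f0 n h ≡ n ∸ j ∸ 1 × deg-g0 n h ≡ n ∸ j ∸ 1) ×
        (2 ≤ cardA n h → j < n ∸ 2))))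
lemma6p1 _ h (s≤s (s≤s (s≤s (z≤n {m})))) H C cardA≡cardB
  with threshold-exists H (2 + m) m (m≤n⇒m≤1+n (n≤1+n _)) (C (suc m) z<s (n≤1+n _))
     | threshold-exists H (3 + m) (suc m) (n≤1+n _) (C (2 + m) z<s ≤-refl)
... | j , 1≤j , j≤n-2 , thr | j′ , 1≤j′ , j′≤n-1 , thr′
  with refl ← equal-cards⇒consecutive-thresholds H 1≤j (m≤n⇒m≤1+n j≤n-2) thr 1≤j′ (m≤n⇒m≤1+n j′≤n-1) thr′ cardA≡cardB
  = j , (InA-j , InA-least)
  , level-set-of-consecutive-thresholds thr thr′ 1≤j j≤n
  , (trans (degf-threshold (n≤1+n _) 1≤j j≤n-1 thr) (sym (∸-∸1 (3 + m) j))
  , trans (degf-threshold ≤-refl 1≤j′ (s≤s j≤n-1) thr′) (sym (∸-∸1 (3 + m) j)))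
  , λ 2≤cardA → s≤s (s≤s⁻¹ (s≤s⁻¹ (m≤o∸n⇒m+n≤o 2 j≤n-1 (≤-trans 2≤cardA (≤-reflexive cardA≡)))))
  where
  j≤n-1 : j ≤ 2 + m
  j≤n-1 = m≤n⇒m≤1+n j≤n-2
  j≤n : j ≤ 3 + m
  j≤n = m≤n⇒m≤1+n j≤n-1
  InA-j : InA (3 + m) h j
  InA-j = (1≤j , j≤n) , s≤s j≤n-2 , from (thr j 1≤j j≤n) ≤-refl
  InA-least : ∀ i → InA (3 + m) h i → j ≤ i
  InA-least i ((1≤i , i≤n) , _ , t≤hi) = to (thr i 1≤i i≤n) t≤hi
  cardA≡ : cardA (3 + m) h ≡ 2 + m ∸ j
  cardA≡ = cardA-threshold 1≤j j≤n-1 thr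
  ∸-∸1 : ∀ a b → a ∸ b ∸ 1 ≡ a ∸ suc b
  ∸-∸1 a b = trans (∸-+-assoc a b 1) (cong (a ∸_) (+-comm b 1))
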